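{- Let $s,t$ be coprime integers greater than $1$, let $\sigma,\tau$ be $(s,t)$-cores, and let $x$ be a peak for $\sigma$ and $\tau$. Then $x$ is a pinch-point for both $\sigma$ and $\tau$.
   Context: Partitions, beta-set $\mathcal B(\lambda)=\{\lambda_r-r:r\ge1\}$. A partition is an $s$-core if it has no rim $s$-hook (connected set of $s$ rim nodes whose removal leaves a partition's diagram); an $(s,t)$-core is both an $s$-core and a $t$-core. For $x\in\mathbb Z$ let $\mathcal L_x=\{x-as-bt:a,b\ge0\}$ and $\mathcal R_x=\{x+as-bt:1\le a\le t,\ 0\le b\le s-1\}$; $x$ is a pinch-point for $\lambda$ if $\mathcal L_x\subseteq\mathcal B(\lambda)\subseteq\mathcal L_x\cup\mathcal R_x$. Peak: for $i\in\mathbb Z/s\mathbb Z$ (a coset $a+s\mathbb Z$) let $\delta_i=\frac1s\big(\max(\mathcal B(\sigma)\cap i)-\max(\mathcal B(\tau)\cap i)\big)$, writing $\delta_a=\delta_{a+s\mathbb Z}$ for $a\in\mathbb Z$. Choose $k\in\{0,\dots,s-1\}$ maximising $\delta_0+\delta_t+\dots+\delta_{kt}$, let $y=kt+s\mathbb Z$ and $x=\max(\mathcal B(\tau)\cap y)$; any such $x$ is a peak for $\sigma$ and $\tau$. -}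

module Defs where

open import Data.Nat as ℕ using (ℕ; zero; suc)
open import Data.Integer as ℤ using (ℤ; +_; _-_)
open import Data.Integer.Divisibility using () renaming (_∣_ to _∣ℤ_)
open import Data.List using (List; []; _∷_)
open import Data.Nat.ListAction using (sum)
open import Data.List.Relation.Unary.All using (All)
open import Data.List.Relation.Unary.Linked using (Linked)
open import Data.Product using (Σ; ∃; ∃-syntax; _×_; _,_)
open import Data.Sum using (_⊎_)
open import Relation.Nullary using (¬_)
open import Relation.Binary.PropositionalEquality using (_≡_)

record Partition : Set where
  constructor mkPartition
  field
    parts      : List ℕ
    decreasing : Linked ℕ._≥_ parts
    positive   : All (0 ℕ.<_) parts
open Partition public

-- r-th part, 0-indexed: part lam r = lam_{r+1}, and 0 beyond the length.
partL : List ℕ → ℕ → ℕ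
partL []       _       = 0
partL (p ∷ ps) zero    = p
partL (p ∷ ps) (suc r) = partL ps r

part : Partition → ℕ → ℕ
part lam = partL (parts lam)

size : Partition → ℕ
size lam = sum (parts lam)

-- Young diagrams. A node is (row , column), both 0-indexed.

Node : Set
Node = ℕ × ℕ

InDiag : Partition → Node → Set
InDiag lam (i , j) = j ℕ.< part lam i

Rim : Partition → Node → Set
Rim lam (i , j) = InDiag lam (i , j) × ¬ InDiag lam (suc i , suc j)

Adjacent : Node → Node → Set
Adjacent (i , j) (k , l) =
  ((i ≡ k) × ((suc j ≡ l) ⊎ (j ≡ suc l))) ⊎
  ((j ≡ l) × ((suc i ≡ k) ⊎ (i ≡ suc k)))

data Path (S : Node → Set) : Node → Node → Set where
  here : ∀ {a} → Path S a a
  step : ∀ {a b c} → Adjacent a b → S b → Path S b c → Path S a c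

Connected : (Node → Set) → Set
Connected S = ∀ a b → S a → S b → Path S a b

-- lam has a rim s-hook: removing a connected set of s rim nodes of lam
-- leaves the diagram of a partition μ (the removed set is lam/μ, whose
-- cardinality is |lam| - |μ| since μ ⊆ lam).
HasRimHook : ℕ → Partition → Set
HasRimHook s lam = Σ Partition λ μ →
  (∀ i → part μ i ℕ.≤ part lam i) ×
  (size lam ≡ size μ ℕ.+ s) ×
  (∀ n → InDiag lam n → ¬ InDiag μ n → Rim lam n) ×
  Connected (λ n → InDiag lam n × ¬ InDiag μ n)

IsCore : ℕ → Partition → Set
IsCore s lam = ¬ HasRimHook s lam

IsBiCore : ℕ → ℕ → Partition → Set
IsBiCore s t lam = IsCore s lam × IsCore t lam

-- Beta-set B(lam) = { lam_r - r : r ≥ 1 }  (here r = r' + 1, r' ≥ 0)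

_∈B_ : ℤ → Partition → Set
z ∈B lam = ∃[ r ] z ≡ + part lam r - + suc r

InL : ℕ → ℕ → ℤ → ℤ → Set
InL s t x z = ∃[ a ] ∃[ b ] z ≡ x - + (a ℕ.* s) - + (b ℕ.* t)

InR : ℕ → ℕ → ℤ → ℤ → Set
InR s t x z = ∃[ a ] ∃[ b ]
  (1 ℕ.≤ a × a ℕ.≤ t × b ℕ.< s × z ≡ x ℤ.+ + (a ℕ.* s) - + (b ℕ.* t))

PinchPoint : ℕ → ℕ → Partition → ℤ → Set
PinchPoint s t lam x =
  (∀ z → InL s t x z → z ∈B lam) ×
  (∀ z → z ∈B lam → InL s t x z ⊎ InR s t x z)

IsClassMax : ℕ → Partition → ℤ → ℤ → Set
IsClassMax s lam a m =
  m ∈B lam × (+ s ∣ℤ (m - a)) ×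
  (∀ z → z ∈B lam → + s ∣ℤ (z - a) → z ℤ.≤ m)

sumUpTo : (ℤ → ℤ) → ℕ → ℕ → ℤ
sumUpTo f t zero    = f (+ 0)
sumUpTo f t (suc k) = sumUpTo f t k ℤ.+ f (+ (suc k ℕ.* t))

-- x is a peak for σ and τ: with Mσ a = max(B(σ) ∩ (a+sℤ)),
-- Mτ a = max(B(τ) ∩ (a+sℤ)) and δ_a = (Mσ a - Mτ a)/s, there is
-- k ∈ {0,…,s-1} maximising δ_0 + δ_t + … + δ_{kt} with
-- x = max(B(τ) ∩ (kt + sℤ)).
IsPeak : ℕ → ℕ → Partition → Partition → ℤ → Set
IsPeak s t σ τ x =
  Σ (ℤ → ℤ) λ Mσ → Σ (ℤ → ℤ) λ Mτ → Σ (ℤ → ℤ) λ δ →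
    (∀ a → IsClassMax s σ a (Mσ a)) ×
    (∀ a → IsClassMax s τ a (Mτ a)) ×
    (∀ a → + s ℤ.* δ a ≡ Mσ a - Mτ a) ×
    (∃[ k ] (k ℕ.< s) ×
       (∀ k′ → k′ ℕ.< s → sumUpTo δ t k′ ℤ.≤ sumUpTo δ t k) ×
       (x ≡ Mτ (+ (k ℕ.* t))))

{-# OPTIONS --safe #-}
-- For an s-core λ the beta-set B(λ) is closed under z ↦ z − s: if z − s were a gap, moving the
-- bead z there would remove a rim s-hook. Hence B(λ) ∩ (a + sℤ) is the whole progression below its
-- maximum, and that maximum is read off from how many beta numbers of the class lie in a large
-- window [−K, K). There are K beta numbers in the window in all, and since s and t are coprime the
-- classes of 0, t, …, (s − 1) t are all the classes, so δ_0 + δ_t + … + δ_{(s−1)t} = 0. At a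
-- maximising k this forces δ_{kt} ≥ 0 ≥ δ_{(k+1)t}: the first puts x = max(B(τ) ∩ (kt + sℤ)) into
-- B(σ), the second bounds the class of x + t by x + t in both beta-sets. Closure under −s and −t
-- gives L_x ⊆ B, and that bound confines everything else in B to R_x.
module Submission where

open import Defs

module Sums where

  open import Data.Nat
  open import Data.Nat.Properties
  open import Data.List using ([]; _∷_; length)
  open import Data.Nat.ListAction using (sum)
  open import Relation.Nullary using (Dec; yes; no; ¬_; contradiction)
  open import Relation.Binary.PropositionalEquality
  open import Data.Nat.Tactic.RingSolver using (solve-∀)
  open import Data.Sum using (inj₁; inj₂)
  open import Function.Base using (_⟨_⟩_)

  ∑< : ℕ → (ℕ → ℕ) → ℕ
  ∑< zero    f = 0
  ∑< (suc n) f = ∑< n f + f n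

  syntax ∑< n (λ i → e) = ∑[ i < n ] e

  𝟙 : {P : Set} → Dec P → ℕ
  𝟙 (yes _) = 1
  𝟙 (no _)  = 0

  𝟙≡1 : {P : Set} (P? : Dec P) → P → 𝟙 P? ≡ 1
  𝟙≡1 (yes _) _ = refl
  𝟙≡1 (no ¬p) p = contradiction p ¬p

  𝟙≡0 : {P : Set} (P? : Dec P) → ¬ P → 𝟙 P? ≡ 0
  𝟙≡0 (yes p) ¬p = contradiction p ¬p
  𝟙≡0 (no _)  _  = refl

  ∑<-cong : ∀ n {f g : ℕ → ℕ} → (∀ i → i < n → f i ≡ g i) → ∑< n f ≡ ∑< n g
  ∑<-cong zero    f≗g = refl
  ∑<-cong (suc n) f≗g = cong₂ _+_ (∑<-cong n (λ i i<n → f≗g i (m<n⇒m<1+n i<n))) (f≗g n ≤-refl)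

  ∑<-zero : ∀ n (f : ℕ → ℕ) → (∀ i → i < n → f i ≡ 0) → ∑< n f ≡ 0
  ∑<-zero n f f≗0 = ∑<-cong n f≗0 ⟨ trans ⟩ zeros n
    where
    zeros : ∀ n → ∑[ _ < n ] 0 ≡ 0
    zeros zero    = refl
    zeros (suc n) = cong (_+ 0) (zeros n)

  ∑<-ones : ∀ n → ∑[ _ < n ] 1 ≡ n
  ∑<-ones zero    = refl
  ∑<-ones (suc n) = cong (_+ 1) (∑<-ones n) ⟨ trans ⟩ +-comm n 1

  ∑<-single : ∀ n (f : ℕ → ℕ) i₀ → i₀ < n → f i₀ ≡ 1 →
              (∀ i → i < n → i ≢ i₀ → f i ≡ 0) → ∑< n f ≡ 1
  ∑<-single (suc n) f i₀ i₀<1+n fi₀≡1 others with m<1+n⇒m<n∨m≡n i₀<1+n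
  ... | inj₁ i₀<n = cong₂ _+_ (∑<-single n f i₀ i₀<n fi₀≡1 (λ i i<n → others i (m<n⇒m<1+n i<n)))
                              (others n ≤-refl (λ n≡i₀ → <-irrefl (sym n≡i₀) i₀<n))
  ... | inj₂ refl = cong₂ _+_ (∑<-zero n f (λ i i<n → others i (m<n⇒m<1+n i<n) (<⇒≢ i<n))) fi₀≡1

  ∑<-+ : ∀ n (f g : ℕ → ℕ) → ∑[ i < n ] (f i + g i) ≡ ∑< n f + ∑< n g
  ∑<-+ zero    f g = refl
  ∑<-+ (suc n) f g rewrite ∑<-+ n f g = interchange (∑< n f) (∑< n g) (f n) (g n)
    where
    interchange : ∀ a b c d → (a + b) + (c + d) ≡ (a + c) + (b + d)
    interchange = solve-∀

  ∑<-*ʳ : ∀ n (f : ℕ → ℕ) c → ∑[ i < n ] (f i * c) ≡ ∑< n f * c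
  ∑<-*ʳ zero    f c = refl
  ∑<-*ʳ (suc n) f c = cong (_+ f n * c) (∑<-*ʳ n f c) ⟨ trans ⟩ sym (*-distribʳ-+ c (∑< n f) (f n))

  ∑<-comm : ∀ m n (g : ℕ → ℕ → ℕ) → ∑[ i < m ] ∑< n (g i) ≡ ∑[ j < n ] ∑[ i < m ] g i j
  ∑<-comm zero    n g = sym (∑<-zero n (λ _ → 0) (λ _ _ → refl))
  ∑<-comm (suc m) n g = cong (_+ ∑< n (g m)) (∑<-comm m n g)
                        ⟨ trans ⟩ sym (∑<-+ n (λ j → ∑[ i < m ] g i j) (g m))

  ∑<-suc : ∀ n (f : ℕ → ℕ) → ∑< (suc n) f ≡ f 0 + ∑[ i < n ] f (suc i)
  ∑<-suc zero    f = +-comm 0 (f 0)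
  ∑<-suc (suc n) f = cong (_+ f (suc n)) (∑<-suc n f) ⟨ trans ⟩ +-assoc (f 0) _ _

  sum≡∑<partL : ∀ l n → length l ≤ n → sum l ≡ ∑< n (partL l)
  sum≡∑<partL []      n       _         = sym (∑<-zero n (partL []) (λ _ _ → refl))
  sum≡∑<partL (p ∷ l) (suc n) (s≤s l≤n) =
    cong (p +_) (sum≡∑<partL l n l≤n) ⟨ trans ⟩ sym (∑<-suc n (partL (p ∷ l)))

module Partitions where

  open import Data.Nat
  open import Data.Nat.Properties
  open import Data.List using (List; []; _∷_; length)
  open import Data.List.Relation.Unary.All using (All; []; _∷_)
  open import Data.List.Relation.Unary.Linked using (Linked; []; [-]; _∷_)
  open import Data.Product using (_,_)
  open import Relation.Binary.PropositionalEquality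

  Decreasing : (ℕ → ℕ) → Set
  Decreasing f = ∀ i → f (suc i) ≤ f i

  decreasing⇒antitone : ∀ {f} → Decreasing f → ∀ {i j} → i ≤ j → f j ≤ f i
  decreasing⇒antitone {f} dec {i} i≤j with m≤n⇒∃[o]m+o≡n i≤j
  ... | k , refl = go k
    where
    go : ∀ k → f (i + k) ≤ f i
    go zero    rewrite +-identityʳ i = ≤-refl
    go (suc k) rewrite +-suc i k     = ≤-trans (dec (i + k)) (go k)

  partL-≥length : ∀ l i → length l ≤ i → partL l i ≡ 0
  partL-≥length []      i       _         = refl
  partL-≥length (_ ∷ l) (suc i) (s≤s l≤i) = partL-≥length l i l≤i

  partL-decreasing : ∀ l → Linked _≥_ l → Decreasing (partL l)
  partL-decreasing []          _        _       = z≤n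
  partL-decreasing (_ ∷ [])    _        _       = z≤n
  partL-decreasing (_ ∷ _ ∷ _) (p≥q ∷ _) zero    = p≥q
  partL-decreasing (_ ∷ q ∷ l) (_ ∷ lk) (suc i) = partL-decreasing (q ∷ l) lk i

  part-decreasing : ∀ lam → Decreasing (part lam)
  part-decreasing lam = partL-decreasing (parts lam) (decreasing lam)

  part-antitone : ∀ lam {i j} → i ≤ j → part lam j ≤ part lam i
  part-antitone lam = decreasing⇒antitone (part-decreasing lam)

  positivePrefix : ℕ → (ℕ → ℕ) → List ℕ
  positivePrefix zero    f = []
  positivePrefix (suc n) f with f 0
  ... | zero  = []
  ... | suc m = suc m ∷ positivePrefix n (λ i → f (suc i))

  positivePrefix-positive : ∀ n f → All (0 <_) (positivePrefix n f)
  positivePrefix-positive zero    f = []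
  positivePrefix-positive (suc n) f with f 0
  ... | zero  = []
  ... | suc m = s≤s z≤n ∷ positivePrefix-positive n _

  positivePrefix-linked-below : ∀ n f → Decreasing f → ∀ x → f 0 ≤ x → Linked _≥_ (x ∷ positivePrefix n f)
  positivePrefix-linked-below zero    f dec x f0≤x = [-]
  positivePrefix-linked-below (suc n) f dec x f0≤x with f 0 in f0≡
  ... | zero  = [-]
  ... | suc m = f0≤x ∷ positivePrefix-linked-below n (λ i → f (suc i)) (λ i → dec (suc i)) (suc m)
                         (subst (f 1 ≤_) f0≡ (dec 0))

  positivePrefix-linked : ∀ n f → Decreasing f → Linked _≥_ (positivePrefix n f)
  positivePrefix-linked zero    f dec = []
  positivePrefix-linked (suc n) f dec with f 0 in f0≡
  ... | zero  = []
  ... | suc m = positivePrefix-linked-below n (λ i → f (suc i)) (λ i → dec (suc i)) (suc m)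
                  (subst (f 1 ≤_) f0≡ (dec 0))

  fromDecreasing : ∀ n f → Decreasing f → Partition
  fromDecreasing n f dec =
    mkPartition (positivePrefix n f) (positivePrefix-linked n f dec) (positivePrefix-positive n f)

  length-positivePrefix : ∀ n f → length (positivePrefix n f) ≤ n
  length-positivePrefix zero    f = z≤n
  length-positivePrefix (suc n) f with f 0
  ... | zero  = z≤n
  ... | suc m = s≤s (length-positivePrefix n _)

  partL-positivePrefix : ∀ n f → Decreasing f → f n ≡ 0 → ∀ i → partL (positivePrefix n f) i ≡ f i
  partL-positivePrefix zero    f dec fn≡0 i = sym (n≤0⇒n≡0 (subst (f i ≤_) fn≡0 (decreasing⇒antitone dec z≤n)))
  partL-positivePrefix (suc n) f dec fn≡0 i with f 0 in f0≡
  partL-positivePrefix (suc n) f dec fn≡0 i       | zero  = sym (n≤0⇒n≡0 (subst (f i ≤_) f0≡ (decreasing⇒antitone dec z≤n)))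
  partL-positivePrefix (suc n) f dec fn≡0 zero    | suc m = sym f0≡
  partL-positivePrefix (suc n) f dec fn≡0 (suc i) | suc m =
    partL-positivePrefix n (λ i → f (suc i)) (λ i → dec (suc i)) fn≡0 i

module RimHooks where

  open import Data.Nat
  open import Data.Nat.Properties
  open import Data.List using (length)
  open import Data.Nat.ListAction using (sum)
  open import Data.Product using (_×_; _,_; proj₂)
  open import Data.Sum using (inj₁; inj₂)
  open import Relation.Nullary using (¬_; yes; no; contradiction)
  open import Relation.Binary.PropositionalEquality
  open import Data.Nat.Tactic.RingSolver using (solve-∀)
  open import Function.Base using (_⟨_⟩_)
  open Sums
  open Partitions

  adjacent-sym : ∀ {a b} → Adjacent a b → Adjacent b a
  adjacent-sym (inj₁ (i≡k , inj₁ e)) = inj₁ (sym i≡k , inj₂ (sym e))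
  adjacent-sym (inj₁ (i≡k , inj₂ e)) = inj₁ (sym i≡k , inj₁ (sym e))
  adjacent-sym (inj₂ (j≡l , inj₁ e)) = inj₂ (sym j≡l , inj₂ (sym e))
  adjacent-sym (inj₂ (j≡l , inj₂ e)) = inj₂ (sym j≡l , inj₁ (sym e))

  module _ {S : Node → Set} where

    _++ᵖ_ : ∀ {a b c} → Path S a b → Path S b c → Path S a c
    here         ++ᵖ q = q
    step adj x p ++ᵖ q = step adj x (p ++ᵖ q)

    reverseᵖ : ∀ {a b} → S a → Path S a b → Path S b a
    reverseᵖ Sa p = go p Sa here
      where
      go : ∀ {a b c} → Path S a b → S a → Path S a c → Path S b c
      go here            Sa acc = acc
      go (step adj Sb p) Sa acc = go p Sb (step (adjacent-sym adj) Sa acc)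

  mapᵖ : ∀ {P Q : Node → Set} → (∀ n → P n → Q n) → ∀ {a b} → Path P a b → Path Q a b
  mapᵖ P⊆Q here           = here
  mapᵖ P⊆Q (step adj x p) = step adj (P⊆Q _ x) (mapᵖ P⊆Q p)

  pred<self : ∀ {m n} → m < n → pred n < n
  pred<self {n = suc n} _ = n<1+n n

  -- In beta-set terms the hypotheses say β_{r+q} > β_r − s > β_{r+q+1}, where β_i = λ_{i+1} − (i+1);
  -- the hook removed is the one that moves the bead β_r to the gap β_r − s.
  module RimHook (lam : Partition) (s r q : ℕ)
                 (above : part lam r + q < s + part lam (r + q))
                 (below : part lam (suc (r + q)) + s ≤ part lam r + q) where

    private
      p : ℕ → ℕ
      p = part lam

    μrow : ℕ → ℕ
    μrow i with i <? r
    ... | yes _ = p i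
    ... | no _ with i <? r + q
    ... | yes _ = pred (p (suc i))
    ... | no _ with i ≟ r + q
    ... | yes _ = p r + q ∸ s
    ... | no _  = p i

    data Region (i : ℕ) : Set where
      north  : i < r → Region i
      middle : r ≤ i → i < r + q → Region i
      corner : i ≡ r + q → Region i
      south  : r + q < i → Region i

    region : ∀ i → Region i
    region i with i <? r
    ... | yes i<r = north i<r
    ... | no i≮r with i <? r + q
    ... | yes i<r+q = middle (≮⇒≥ i≮r) i<r+q
    ... | no i≮r+q with i ≟ r + q
    ... | yes i≡r+q = corner i≡r+q
    ... | no i≢r+q  = south (≤∧≢⇒< (≮⇒≥ i≮r+q) (λ r+q≡i → i≢r+q (sym r+q≡i)))

    μrow-north : ∀ i → i < r → μrow i ≡ p i
    μrow-north i i<r with i <? r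
    ... | yes _  = refl
    ... | no i≮r = contradiction i<r i≮r

    μrow-middle : ∀ i → r ≤ i → i < r + q → μrow i ≡ pred (p (suc i))
    μrow-middle i r≤i i<r+q with i <? r
    ... | yes i<r = contradiction r≤i (<⇒≱ i<r)
    ... | no _ with i <? r + q
    ... | yes _ = refl
    ... | no i≮r+q = contradiction i<r+q i≮r+q

    μrow-corner : μrow (r + q) ≡ p r + q ∸ s
    μrow-corner with (r + q) <? r
    ... | yes r+q<r = contradiction (m≤m+n r q) (<⇒≱ r+q<r)
    ... | no _ with (r + q) <? r + q
    ... | yes r+q<r+q = contradiction r+q<r+q (<-irrefl refl)
    ... | no _ with (r + q) ≟ r + q
    ... | yes _ = refl
    ... | no r+q≢r+q = contradiction refl r+q≢r+q

    μrow-south : ∀ i → r + q < i → μrow i ≡ p i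
    μrow-south i r+q<i with i <? r
    ... | yes i<r = contradiction (≤-trans (m≤m+n r q) (<⇒≤ r+q<i)) (<⇒≱ i<r)
    ... | no _ with i <? r + q
    ... | yes i<r+q = contradiction r+q<i (<-asym i<r+q)
    ... | no _ with i ≟ r + q
    ... | yes i≡r+q = contradiction (sym i≡r+q) (<⇒≢ r+q<i)
    ... | no _ = refl

    private
      dec : Decreasing p
      dec = part-decreasing lam

      p[r+q+1]<p[r+q] : p (suc (r + q)) < p (r + q)
      p[r+q+1]<p[r+q] = +-cancelʳ-< s _ _ (≤-<-trans below (subst (p r + q <_) (+-comm s (p (r + q))) above))

      p-middle-positive : ∀ i → i < r + q → 0 < p (suc i)
      p-middle-positive i i<r+q = ≤-trans (≤-<-trans z≤n p[r+q+1]<p[r+q]) (part-antitone lam i<r+q)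

      s≤p[r]+q : s ≤ p r + q
      s≤p[r]+q = ≤-trans (m≤n+m s _) below

      corner≤ : p r + q ∸ s ≤ pred (p (r + q))
      corner≤ = ≤-trans (∸-monoˡ-≤ s (<⇒≤pred above))
                  (≤-reflexive (pred[s+n]∸s (p (r + q)) (≤-<-trans z≤n p[r+q+1]<p[r+q])))
        where
        pred[s+n]∸s : ∀ n → 0 < n → pred (s + n) ∸ s ≡ pred n
        pred[s+n]∸s (suc n) _ = cong (λ m → pred m ∸ s) (+-suc s n) ⟨ trans ⟩ m+n∸m≡n s n

      ≤corner : p (suc (r + q)) ≤ p r + q ∸ s
      ≤corner = ≤-trans (≤-reflexive (sym (m+n∸n≡m _ s))) (∸-monoˡ-≤ s below)

    μrow≤p : ∀ i → μrow i ≤ p i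
    μrow≤p i with region i
    ... | north i<r       rewrite μrow-north i i<r = ≤-refl
    ... | middle r≤i i<rq rewrite μrow-middle i r≤i i<rq = ≤-trans pred[n]≤n (dec i)
    ... | corner refl     rewrite μrow-corner = ≤-trans corner≤ pred[n]≤n
    ... | south rq<i      rewrite μrow-south i rq<i = ≤-refl

    μrow-decreasing : Decreasing μrow
    μrow-decreasing i with region i
    ... | north i<r rewrite μrow-north i i<r = ≤-trans (μrow≤p (suc i)) (dec i)
    ... | middle r≤i i<rq rewrite μrow-middle i r≤i i<rq with suc i <? r + q
    ...   | yes i+1<rq rewrite μrow-middle (suc i) (m≤n⇒m≤1+n r≤i) i+1<rq = pred-mono-≤ (dec (suc i))
    ...   | no i+1≮rq rewrite ≤-antisym i<rq (≮⇒≥ i+1≮rq) | μrow-corner = corner≤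
    μrow-decreasing i | corner refl rewrite μrow-corner | μrow-south (suc (r + q)) ≤-refl = ≤corner
    μrow-decreasing i | south rq<i rewrite μrow-south i rq<i | μrow-south (suc i) (m<n⇒m<1+n rq<i) = dec i

    removed-rows : ∀ i → μrow i < p i → r ≤ i × i ≤ r + q
    removed-rows i μi<pi with region i
    ... | north i<r rewrite μrow-north i i<r = contradiction μi<pi (<-irrefl refl)
    ... | middle r≤i i<rq = r≤i , <⇒≤ i<rq
    ... | corner refl = m≤m+n r q , ≤-refl
    ... | south rq<i rewrite μrow-south i rq<i = contradiction μi<pi (<-irrefl refl)

    removed-rim : ∀ i → μrow i < p i → p (suc i) ≤ suc (μrow i)
    removed-rim i μi<pi with region i
    ... | north i<r rewrite μrow-north i i<r = contradiction μi<pi (<-irrefl refl)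
    ... | middle r≤i i<rq rewrite μrow-middle i r≤i i<rq = m≤1+pred[m] (p (suc i))
      where
      m≤1+pred[m] : ∀ m → m ≤ suc (pred m)
      m≤1+pred[m] zero    = z≤n
      m≤1+pred[m] (suc m) = ≤-refl
    ... | corner refl rewrite μrow-corner = m≤n⇒m≤1+n ≤corner
    ... | south rq<i rewrite μrow-south i rq<i = contradiction μi<pi (<-irrefl refl)

    private
      ∑μrow-north : ∀ n → n ≤ r → ∑< n μrow ≡ ∑< n p
      ∑μrow-north zero    _       = refl
      ∑μrow-north (suc n) 1+n≤r = cong₂ _+_ (∑μrow-north n (<⇒≤ 1+n≤r)) (μrow-north n 1+n≤r)

      -- telescopes, since μrow i = p (i + 1) − 1 on the hook rows
      ∑μrow-middle : ∀ e → e ≤ q → ∑< (r + e) μrow + e + p r ≡ ∑< (r + e) p + p (r + e)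
      ∑μrow-middle zero    _ rewrite +-identityʳ r | +-identityʳ (∑< r μrow) | ∑μrow-north r ≤-refl = refl
      ∑μrow-middle (suc e) 1+e≤q
        rewrite +-suc r e | μrow-middle (r + e) (m≤m+n r e) (+-monoʳ-< r 1+e≤q)
        with p (suc (r + e)) | p-middle-positive (r + e) (+-monoʳ-< r 1+e≤q)
      ... | suc u | _ = begin
        ∑< (r + e) μrow + u + suc e + p r   ≡⟨ shuffle (∑< (r + e) μrow) u e (p r) ⟩
        ∑< (r + e) μrow + e + p r + suc u   ≡⟨ cong (_+ suc u) (∑μrow-middle e (<⇒≤ 1+e≤q)) ⟩
        ∑< (r + e) p + p (r + e) + suc u ∎
        where
        open ≡-Reasoning
        shuffle : ∀ a u e b → a + u + suc e + b ≡ (a + e + b) + suc u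
        shuffle = solve-∀

      ∑μrow-corner : ∑< (suc (r + q)) μrow + s ≡ ∑< (suc (r + q)) p
      ∑μrow-corner = begin
        ∑< (r + q) μrow + μrow (r + q) + s       ≡⟨ cong (λ c → ∑< (r + q) μrow + c + s) μrow-corner ⟩
        ∑< (r + q) μrow + (p r + q ∸ s) + s   ≡⟨ +-assoc (∑< (r + q) μrow) _ s ⟩
        ∑< (r + q) μrow + (p r + q ∸ s + s)   ≡⟨ cong (∑< (r + q) μrow +_) (m∸n+n≡m s≤p[r]+q) ⟩
        ∑< (r + q) μrow + (p r + q)           ≡⟨ reassoc (∑< (r + q) μrow) (p r) q ⟩
        ∑< (r + q) μrow + q + p r             ≡⟨ ∑μrow-middle q ≤-refl ⟩
        ∑< (r + q) p + p (r + q)           ∎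
        where
        open ≡-Reasoning
        reassoc : ∀ a b c → a + (b + c) ≡ a + c + b
        reassoc = solve-∀

      ∑μrow-south : ∀ m → r + q < m → ∑< m μrow + s ≡ ∑< m p
      ∑μrow-south (suc m) (s≤s r+q≤m) with m≤n⇒m<n∨m≡n r+q≤m
      ... | inj₂ refl = ∑μrow-corner
      ... | inj₁ r+q<m = begin
        ∑< m μrow + μrow m + s   ≡⟨ cong (λ c → ∑< m μrow + c + s) (μrow-south m r+q<m) ⟩
        ∑< m μrow + p m + s   ≡⟨ +-comm-middle (∑< m μrow) (p m) s ⟩
        ∑< m μrow + s + p m   ≡⟨ cong (_+ p m) (∑μrow-south m r+q<m) ⟩
        ∑< m p + p m       ∎
        where
        open ≡-Reasoning
        +-comm-middle : ∀ a b c → a + b + c ≡ a + c + b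
        +-comm-middle = solve-∀

      N : ℕ
      N = suc (r + q) + length (parts lam)

      μrow[N]≡0 : μrow N ≡ 0
      μrow[N]≡0 rewrite μrow-south N (m≤m+n (suc (r + q)) _) = partL-≥length (parts lam) N (m≤n+m _ _)

    μ : Partition
    μ = fromDecreasing N μrow μrow-decreasing

    part-μ : ∀ i → part μ i ≡ μrow i
    part-μ = partL-positivePrefix N μrow μrow-decreasing μrow[N]≡0

    size-μ : size lam ≡ size μ + s
    size-μ = begin
      sum (parts lam)  ≡⟨ sum≡∑<partL (parts lam) N (m≤n+m _ _) ⟩
      ∑< N p           ≡⟨ ∑μrow-south N (m≤m+n (suc (r + q)) _) ⟨
      ∑< N μrow + s       ≡⟨ cong (_+ s) (∑<-cong N (λ i _ → sym (part-μ i)) ⟨ trans ⟩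
                                       sym (sum≡∑<partL (parts μ) N (length-positivePrefix N μrow))) ⟩
      sum (parts μ) + s ∎
      where
      open ≡-Reasoning

    Removed : Node → Set
    Removed (i , j) = j < p i × μrow i ≤ j

    private
      rowEnd : ℕ → Node
      rowEnd i = (i , pred (p i))

      alongRow : ∀ k i j → Removed (i , j) → j + k ≡ pred (p i) → Path Removed (i , j) (rowEnd i)
      alongRow zero i j _ j≡end rewrite +-identityʳ j = subst (λ c → Path Removed (i , j) (i , c)) j≡end here
      alongRow (suc k) i j (j<pi , μi≤j) j+1+k≡end =
        step (inj₁ (refl , inj₁ refl)) next (alongRow k i (suc j) next (sym (+-suc j k) ⟨ trans ⟩ j+1+k≡end))
        where
        next : Removed (i , suc j)
        next = ≤-<-trans (≤-trans (m≤m+n (suc j) k) (≤-reflexive (sym (+-suc j k) ⟨ trans ⟩ j+1+k≡end)))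
                         (pred<self j<pi)
               , m≤n⇒m≤1+n μi≤j

      -- the node above the end of hook row i + 1 is removed as well, since μrow i = p (i + 1) − 1
      upColumn : ∀ m → Removed (rowEnd (r + m)) → Path Removed (rowEnd (r + m)) (rowEnd r)
      upColumn zero rewrite +-identityʳ r = λ _ → here
      upColumn (suc m) (end<pi , μi≤end) rewrite +-suc r m =
        step (inj₂ (refl , inj₂ refl)) landing
          (alongRow (pred (p i) ∸ c) i c landing (m+[n∸m]≡n (<⇒≤pred c<pi)) ++ᵖ upColumn m (end-removed , μi≤pred))
        where
        i c : ℕ
        i = r + m
        c = pred (p (suc i))
        i<r+q : i < r + q
        i<r+q = proj₂ (removed-rows (suc i) (≤-<-trans μi≤end end<pi))
        μi≡c : μrow i ≡ c
        μi≡c = μrow-middle i (m≤m+n r m) i<r+q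
        c<pi : c < p i
        c<pi = <-≤-trans end<pi (dec i)
        landing : Removed (i , c)
        landing = c<pi , ≤-reflexive μi≡c
        end-removed : pred (p i) < p i
        end-removed = pred<self c<pi
        μi≤pred : μrow i ≤ pred (p i)
        μi≤pred = ≤-trans (≤-reflexive μi≡c) (<⇒≤pred c<pi)

      toHead : ∀ n → Removed n → Path Removed n (rowEnd r)
      toHead (i , j) (j<pi , μi≤j) with removed-rows i (≤-<-trans μi≤j j<pi)
      ... | r≤i , _ with m≤n⇒∃[o]m+o≡n r≤i
      ... | m , refl =
        alongRow (pred (p (r + m)) ∸ j) (r + m) j (j<pi , μi≤j) (m+[n∸m]≡n (<⇒≤pred j<pi))
        ++ᵖ upColumn m (pred<self j<pi , ≤-trans μi≤j (<⇒≤pred j<pi))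

    removed-skew : ∀ n → InDiag lam n × ¬ InDiag μ n → Removed n
    removed-skew (i , j) (j<pi , j≮μi) = j<pi , subst (_≤ j) (part-μ i) (≮⇒≥ j≮μi)

    skew-removed : ∀ n → Removed n → InDiag lam n × ¬ InDiag μ n
    skew-removed (i , j) (j<pi , μi≤j) = j<pi , λ j<μi → <⇒≱ j<μi (subst (_≤ j) (sym (part-μ i)) μi≤j)

    hook : HasRimHook s lam
    hook = μ , μ⊆lam , size-μ , rim , connected
      where
      μ⊆lam : ∀ i → part μ i ≤ p i
      μ⊆lam i = subst (_≤ p i) (sym (part-μ i)) (μrow≤p i)
      rim : ∀ n → InDiag lam n → ¬ InDiag μ n → Rim lam n
      rim (i , j) j<pi j≮μi with removed-skew (i , j) (j<pi , j≮μi)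
      ... | _ , μi≤j = j<pi , λ j+1<pi+1 → <⇒≱ j+1<pi+1 (≤-trans (removed-rim i (≤-<-trans μi≤j j<pi)) (s≤s μi≤j))
      connected : Connected (λ n → InDiag lam n × ¬ InDiag μ n)
      connected a b a∈ b∈ = mapᵖ skew-removed
        (toHead a (removed-skew a a∈) ++ᵖ reverseᵖ (removed-skew b b∈) (toHead b (removed-skew b b∈)))

module CoreClosure where

  open import Data.Nat as ℕ using (ℕ; zero; suc)
  import Data.Nat.Properties as ℕ
  open import Data.Integer using (ℤ; +_; _+_; _-_; 1ℤ)
  import Data.Integer.Properties as ℤ
  open import Data.Integer.Tactic.RingSolver using (solve-∀)
  open import Data.Product using (∃-syntax; _×_; _,_)
  open import Data.Sum using (inj₁; inj₂)
  open import Relation.Nullary using (¬_; yes; no; contradiction)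
  open import Relation.Unary using (Decidable)
  open import Relation.Binary.PropositionalEquality
  open import Function.Base using (_⟨_⟩_)
  open Partitions
  open RimHooks

  boundary : ∀ (P : ℕ → Set) → Decidable P → P 0 → ∀ n → ¬ P n → ∃[ q ] P q × ¬ P (suc q)
  boundary P P? P0 zero    ¬Pn = contradiction P0 ¬Pn
  boundary P P? P0 (suc n) ¬P[1+n] with P? n
  ... | yes Pn = n , Pn , ¬P[1+n]
  ... | no ¬Pn = boundary P P? P0 n ¬Pn

  Closed : ℕ → Partition → Set
  Closed n lam = ∀ z → z ∈B lam → (z - + n) ∈B lam

  private
    β-shift : ∀ a b r q s → b ℕ.+ s ≡ suc (a ℕ.+ q) →
              (+ a - + suc r) - + s ≡ + b - + suc (suc (r ℕ.+ q))
    β-shift a b r q s b+s≡ = begin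
      (+ a - (1ℤ + + r)) - + s                                   ≡⟨ identity (+ a) (+ b) (+ r) (+ q) (+ s) ⟩
      (+ b - (1ℤ + (1ℤ + (+ r + + q)))) + ((+ a + + q + 1ℤ) - (+ b + + s))
        ≡⟨ cong (λ c → (+ b - + suc (suc (r ℕ.+ q))) + (c - (+ b + + s))) (sym (cong +_ b+s≡ ⟨ trans ⟩ ℤ.+-comm 1ℤ (+ a + + q))) ⟩
      (+ b - + suc (suc (r ℕ.+ q))) + ((+ b + + s) - (+ b + + s)) ≡⟨ cong (λ c → (+ b - + suc (suc (r ℕ.+ q))) + c) (ℤ.+-inverseʳ (+ b + + s)) ⟩
      (+ b - + suc (suc (r ℕ.+ q))) + + 0                          ≡⟨ ℤ.+-identityʳ _ ⟩
      + b - + suc (suc (r ℕ.+ q))                                  ∎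
      where
      open ≡-Reasoning
      identity : ∀ a b r q s → (a - (1ℤ + r)) - s ≡ (b - (1ℤ + (1ℤ + (r + q)))) + ((a + q + 1ℤ) - (b + s))
      identity = solve-∀

  -- The rows r, r+1, … are scanned for the first beta number at most β_r − s: either it is β_r − s,
  -- or β_r − s is a gap and moving the bead β_r there removes a rim s-hook.
  core⇒closed : ∀ s lam → 0 ℕ.< s → IsCore s lam → Closed s lam
  core⇒closed s lam 0<s core z (r , refl) = fill (boundary Above (λ q → _ ℕ.<? _) above₀ s ¬above-s)
    where
    p : ℕ → ℕ
    p = part lam

    Above : ℕ → Set
    Above q = p r ℕ.+ q ℕ.< s ℕ.+ p (r ℕ.+ q)

    above₀ : Above 0
    above₀ rewrite ℕ.+-identityʳ (p r) | ℕ.+-identityʳ r = ℕ.m<n+m (p r) 0<s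

    ¬above-s : ¬ Above s
    ¬above-s above-s = ℕ.<-irrefl refl (ℕ.<-≤-trans above-s
      (ℕ.≤-trans (ℕ.+-monoʳ-≤ s (part-antitone lam (ℕ.m≤m+n r s))) (ℕ.≤-reflexive (ℕ.+-comm s (p r)))))

    crossed : ∀ q → ¬ Above (suc q) → p (suc (r ℕ.+ q)) ℕ.+ s ℕ.≤ suc (p r ℕ.+ q)
    crossed q ¬above rewrite ℕ.+-comm (p (suc (r ℕ.+ q))) s | sym (ℕ.+-suc (p r) q) | sym (ℕ.+-suc r q) =
      ℕ.≮⇒≥ ¬above

    fill : ∃[ q ] Above q × ¬ Above (suc q) → ((+ p r - + suc r) - + s) ∈B lam
    fill (q , above , ¬above) with ℕ.m≤n⇒m<n∨m≡n (crossed q ¬above)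
    ... | inj₁ jumped = contradiction (RimHook.hook lam s r q above (ℕ.≤-pred jumped)) core
    ... | inj₂ landed = suc (r ℕ.+ q) , β-shift (p r) (p (suc (r ℕ.+ q))) r q s landed

  closed-multiple : ∀ {n lam} → Closed n lam → ∀ a z → z ∈B lam → (z - + (a ℕ.* n)) ∈B lam
  closed-multiple {n} {lam} closed zero    z z∈ = subst (_∈B lam) (sym (ℤ.+-identityʳ z)) z∈
  closed-multiple {n} {lam} closed (suc a) z z∈ =
    subst (_∈B lam) (reassoc z (+ (a ℕ.* n)) (+ n) ⟨ trans ⟩ cong (z -_) (sym (ℤ.pos-+ n (a ℕ.* n))))
          (closed _ (closed-multiple {n} {lam} closed a z z∈))
    where
    reassoc : ∀ z u v → z - u - v ≡ z - (v + u)
    reassoc = solve-∀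

module ResidueClasses where

  open import Data.Nat as ℕ using (ℕ; zero; suc; NonZero)
  import Data.Nat.Properties as ℕ
  import Data.Nat.Divisibility as ℕ
  open import Data.Nat.Coprimality using (Coprime; coprime-Bézout; coprime-divisor)
  open import Data.Nat.GCD using (module Bézout)
  open import Data.Integer using (ℤ; +_; _+_; _-_; _*_; -_; 1ℤ; _%ℕ_; _/ℕ_)
  import Data.Integer.Properties as ℤ
  open import Data.Integer.DivMod using (n%ℕd<d; a≡a%ℕn+[a/ℕn]*n)
  open import Data.Integer.Divisibility.Signed using (_∣_; divides; _∣?_; ∣⇒∣ᵤ; ∣m∣n⇒∣m-n)
  open import Data.Integer.Tactic.RingSolver using (solve-∀)
  open import Data.Product using (∃-syntax; _×_; _,_)
  open import Data.Sum using (inj₁; inj₂)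
  open import Relation.Nullary using (contradiction)
  open import Relation.Binary.PropositionalEquality
  open import Function.Base using (_⟨_⟩_)
  open Sums

  module Residues (s t : ℕ) .{{_ : NonZero s}} (coprime : Coprime s t) where

    inverse : ∃[ u ] + s ∣ u * + t - 1ℤ
    inverse with coprime-Bézout coprime
    ... | Bézout.+- x y 1+yt≡xs = - + y , divides (- + x) (begin
      - + y * + t - 1ℤ     ≡⟨ negate (+ y) (+ t) ⟩
      - (1ℤ + + y * + t)   ≡⟨ cong -_ (cong (λ c → 1ℤ + c) (sym (ℤ.pos-* y t)) ⟨ trans ⟩ cong +_ 1+yt≡xs ⟨ trans ⟩ ℤ.pos-* x s) ⟩
      - (+ x * + s)        ≡⟨ ℤ.neg-distribˡ-* (+ x) (+ s) ⟩
      - + x * + s          ∎)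
      where
      open ≡-Reasoning
      negate : ∀ y t → - y * t - 1ℤ ≡ - (1ℤ + y * t)
      negate = solve-∀
    ... | Bézout.-+ x y 1+xs≡yt = + y , divides (+ x) (begin
      + y * + t - 1ℤ       ≡⟨ cong (_- 1ℤ) (sym (ℤ.pos-* y t) ⟨ trans ⟩ cong +_ (sym 1+xs≡yt)) ⟩
      (1ℤ + + (x ℕ.* s)) - 1ℤ ≡⟨ cancel (+ (x ℕ.* s)) ⟩
      + (x ℕ.* s)          ≡⟨ ℤ.pos-* x s ⟩
      + x * + s            ∎)
      where
      open ≡-Reasoning
      cancel : ∀ a → (1ℤ + a) - 1ℤ ≡ a
      cancel = solve-∀

    -- j = u n mod s for an inverse u of t modulo s
    residue : ∀ n → ∃[ j ] j ℕ.< s × + s ∣ n - + (j ℕ.* t)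
    residue n with inverse
    ... | u , divides e ut-1≡es = j , n%ℕd<d (u * n) s , divides (d * + t - n * e) (begin
      n - + (j ℕ.* t)                           ≡⟨ cong (λ c → n - c) (ℤ.pos-* j t) ⟩
      n - + j * + t                             ≡⟨ cong (λ c → n - c * + t) j≡ ⟩
      n - (u * n - d * + s) * + t               ≡⟨ expand n u d (+ s) (+ t) e ⟩
      (d * + t - n * e) * + s - n * (u * + t - 1ℤ - e * + s)
                                                ≡⟨ cong (λ c → (d * + t - n * e) * + s - n * (c - e * + s)) ut-1≡es ⟩
      (d * + t - n * e) * + s - n * (e * + s - e * + s)
                                                ≡⟨ vanish (d * + t - n * e) (+ s) n (e * + s) ⟩
      (d * + t - n * e) * + s                   ∎)
      where
      open ≡-Reasoning
      j : ℕ
      j = (u * n) %ℕ s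
      d : ℤ
      d = (u * n) /ℕ s
      j≡ : + j ≡ u * n - d * + s
      j≡ = sym (cong (_- d * + s) (a≡a%ℕn+[a/ℕn]*n (u * n) s) ⟨ trans ⟩ cancel (+ j) (d * + s))
        where
        cancel : ∀ a b → a + b - b ≡ a
        cancel = solve-∀
      expand : ∀ n u d s t e → n - (u * n - d * s) * t ≡ (d * t - n * e) * s - n * (u * t - 1ℤ - e * s)
      expand = solve-∀
      vanish : ∀ a s n b → a * s - n * (b - b) ≡ a * s
      vanish = solve-∀

    private
      residue-unique-≤ : ∀ n {j j′} → j ℕ.≤ j′ → j′ ℕ.< s →
                         + s ∣ n - + (j ℕ.* t) → + s ∣ n - + (j′ ℕ.* t) → j ≡ j′
      residue-unique-≤ n {j} j≤j′ j′<s s∣n-jt s∣n-j′t with ℕ.m≤n⇒∃[o]m+o≡n j≤j′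
      ... | zero  , refl = sym (ℕ.+-identityʳ j)
      ... | suc k , refl = contradiction (ℕ.∣⇒≤ s∣1+k) (ℕ.<⇒≱ (ℕ.≤-<-trans (ℕ.m≤n+m (suc k) j) j′<s))
        where
        difference : (n - + (j ℕ.* t)) - (n - + ((j ℕ.+ suc k) ℕ.* t)) ≡ + (suc k ℕ.* t)
        difference = begin
          (n - + (j ℕ.* t)) - (n - + ((j ℕ.+ suc k) ℕ.* t))
            ≡⟨ cong₂ (λ a b → (n - a) - (n - b)) (ℤ.pos-* j t) (ℤ.pos-* (j ℕ.+ suc k) t ⟨ trans ⟩ cong (_* + t) (ℤ.pos-+ j (suc k))) ⟩
          (n - + j * + t) - (n - (+ j + + suc k) * + t) ≡⟨ cancel n (+ j) (+ suc k) (+ t) ⟩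
          + suc k * + t                                   ≡⟨ ℤ.pos-* (suc k) t ⟨
          + (suc k ℕ.* t)                                 ∎
          where
          open ≡-Reasoning
          cancel : ∀ n j k t → (n - j * t) - (n - (j + k) * t) ≡ k * t
          cancel = solve-∀
        s∣1+k : s ℕ.∣ suc k
        s∣1+k = coprime-divisor coprime (subst (s ℕ.∣_) (ℕ.*-comm (suc k) t)
                  (∣⇒∣ᵤ (subst (+ s ∣_) difference (∣m∣n⇒∣m-n s∣n-jt s∣n-j′t))))

    residue-unique : ∀ n {j j′} → j ℕ.< s → j′ ℕ.< s →
                     + s ∣ n - + (j ℕ.* t) → + s ∣ n - + (j′ ℕ.* t) → j ≡ j′
    residue-unique n {j} {j′} j<s j′<s s∣n-jt s∣n-j′t with ℕ.≤-total j j′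
    ... | inj₁ j≤j′ = residue-unique-≤ n j≤j′ j′<s s∣n-jt s∣n-j′t
    ... | inj₂ j′≤j = sym (residue-unique-≤ n j′≤j j<s s∣n-j′t s∣n-jt)

    ∑-residues : ∀ n → ∑[ j < s ] 𝟙 (+ s ∣? n - + (j ℕ.* t)) ≡ 1
    ∑-residues n = count (residue n)
      where
      inResidue : ℕ → ℕ
      inResidue j = 𝟙 (+ s ∣? n - + (j ℕ.* t))
      count : ∃[ j₀ ] j₀ ℕ.< s × + s ∣ n - + (j₀ ℕ.* t) → ∑< s inResidue ≡ 1
      count (j₀ , j₀<s , s∣n-j₀t) = ∑<-single s inResidue j₀ j₀<s (𝟙≡1 (+ s ∣? n - + (j₀ ℕ.* t)) s∣n-j₀t)
        (λ j j<s j≢j₀ → 𝟙≡0 (+ s ∣? n - + (j ℕ.* t)) (λ s∣n-jt → j≢j₀ (residue-unique n j<s j₀<s s∣n-jt s∣n-j₀t)))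

module Abacus where

  open import Data.Nat as ℕ using (ℕ; zero; suc; NonZero; z≤n; s≤s)
  import Data.Nat.Properties as ℕ
  import Data.Nat.Divisibility as ℕ
  open import Data.Integer using (ℤ; +_; +[1+_]; -[1+_]; -<+; _+_; _-_; _*_; -_; 0ℤ; _≤_; _<_; _≤?_; ∣_∣; +≤+; +<+)
  import Data.Integer.Properties as ℤ
  open import Data.Integer.Properties using (_≟_)
  open import Data.Integer.Divisibility.Signed using (_∣_; divides; _∣?_; ∣⇒∣ᵤ; ∣ᵤ⇒∣; ∣m∣n⇒∣m-n; ∣m∣n⇒∣m+n; ∣-refl)
  open import Data.Integer.Tactic.RingSolver using (solve-∀)
  open import Data.Product using (∃-syntax; _×_; _,_)
  open import Data.Sum using (inj₁; inj₂)
  open import Relation.Nullary using (¬_; yes; no; contradiction)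
  open import Relation.Binary.PropositionalEquality
  open import Function.Base using (_⟨_⟩_)
  open import Data.List using (length)
  open import Relation.Binary.Definitions using (tri<; tri≈; tri>)
  open Sums
  open ResidueClasses using (module Residues)
  open import Data.Nat.Coprimality using (Coprime)
  open Partitions
  open CoreClosure

  ≤-by-difference : ∀ {a b} d → 0ℤ ≤ d → b - a ≡ d → a ≤ b
  ≤-by-difference d 0≤d b-a≡d = ℤ.0≤i-j⇒j≤i (subst (0ℤ ≤_) (sym b-a≡d) 0≤d)

  multiple-≥ : ∀ s {d} → + s ∣ d → 0ℤ ≤ d → d ≢ 0ℤ → + s ≤ d
  multiple-≥ s {+ zero}   _   _ d≢0 = contradiction refl d≢0
  multiple-≥ s {+[1+ n ]} s∣d _ _   = +≤+ (ℕ.∣⇒≤ (∣⇒∣ᵤ s∣d))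

  nonneg-multiple : ∀ s {d} → + s ∣ d → 0ℤ ≤ d → ∃[ m ] d ≡ + (m ℕ.* s)
  nonneg-multiple s {+ n} s∣d _ with ∣⇒∣ᵤ s∣d
  ... | ℕ.divides m n≡ms = m , cong +_ n≡ms

  class-+s : ∀ s c X → + s ∣ X - c → + s ∣ (X + + s) - c
  class-+s s c X s∣X-c = subst (+ s ∣_) (rearrange X c (+ s)) (∣m∣n⇒∣m+n s∣X-c ∣-refl)
    where
    rearrange : ∀ x c s → (x - c) + s ≡ (x + s) - c
    rearrange = solve-∀

  <+nonZero : ∀ s .{{_ : NonZero s}} X → X < X + + s
  <+nonZero s X = subst (_< X + + s) (ℤ.+-identityʳ X) (ℤ.+-monoʳ-< X (+<+ (ℕ.>-nonZero⁻¹ s)))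

  max-∈B : ∀ {s} lam {c m} → IsClassMax s lam c m → m ∈B lam
  max-∈B lam (m∈B , _ , _) = m∈B

  max-class : ∀ {s} lam {c m} → IsClassMax s lam c m → + s ∣ m - c
  max-class lam (_ , s∣m-c , _) = ∣ᵤ⇒∣ s∣m-c

  max-greatest : ∀ {s} lam {c m} → IsClassMax s lam c m → ∀ z → z ∈B lam → + s ∣ z - c → z ≤ m
  max-greatest lam (_ , _ , greatest) z z∈B s∣z-c = greatest z z∈B (∣⇒∣ᵤ s∣z-c)

  max-unique : ∀ {s} lam {c c′ m m′} → IsClassMax s lam c m → IsClassMax s lam c′ m′ → + s ∣ c - c′ → m ≡ m′
  max-unique {s} lam {c} {c′} {m} {m′} isMax isMax′ s∣c-c′ = ℤ.≤-antisym
    (max-greatest lam isMax′ m (max-∈B lam isMax) (subst (+ s ∣_) (chain m c c′) (∣m∣n⇒∣m+n (max-class lam isMax) s∣c-c′)))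
    (max-greatest lam isMax m′ (max-∈B lam isMax′) (subst (+ s ∣_) (chain′ m′ c c′) (∣m∣n⇒∣m-n (max-class lam isMax′) s∣c-c′)))
    where
    chain : ∀ m c c′ → (m - c) + (c - c′) ≡ m - c′
    chain = solve-∀
    chain′ : ∀ m c c′ → (m - c′) - (c - c′) ≡ m - c
    chain′ = solve-∀

  cancel-class : ∀ y x c → (y - c) - (x - c) ≡ y - x
  cancel-class = solve-∀

  below-max : ∀ {s} lam {c m} → Closed s lam → IsClassMax s lam c m → ∀ n → + s ∣ n - c → n ≤ m → n ∈B lam
  below-max {s} lam {c} {m} closed isMax n s∣n-c n≤m
    with nonneg-multiple s (subst (+ s ∣_) (cancel-class m n c) (∣m∣n⇒∣m-n (max-class lam isMax) s∣n-c))
                           (ℤ.i≤j⇒0≤j-i n≤m)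
  ... | a , m-n≡as = subst (_∈B lam) (cong (λ k → m - k) (sym m-n≡as) ⟨ trans ⟩ cancel m n) (closed-multiple {s} {lam} closed a m (max-∈B lam isMax))
    where
    cancel : ∀ m n → m - (m - n) ≡ n
    cancel = solve-∀

  module Window (s K : ℕ) .{{_ : NonZero s}} where

    slot : ℕ → ℤ
    slot i = + i - + K

    InWindow : ℤ → Set
    InWindow v = - + K ≤ v × v < + K

    slot-injective : ∀ {i j} → slot i ≡ slot j → i ≡ j
    slot-injective {i} {j} eq = ℤ.+-injective (cancel (+ i) (+ K) ⟨ trans ⟩ cong (_+ + K) eq ⟨ trans ⟩ sym (cancel (+ j) (+ K)))
      where
      cancel : ∀ a k → a ≡ a - k + k
      cancel = solve-∀

    slot-onto : ∀ v → InWindow v → ∃[ i ] i ℕ.< K ℕ.+ K × slot i ≡ v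
    slot-onto v (-K≤v , v<K) = ∣ v + + K ∣ , ℤ.drop‿+<+ i<K+K , (cong (_- + K) i≡v+K ⟨ trans ⟩ cancel v (+ K))
      where
      i≡v+K : + ∣ v + + K ∣ ≡ v + + K
      i≡v+K = ℤ.0≤i⇒+∣i∣≡i (subst (0ℤ ≤_) (cong (λ k → v + k) (ℤ.neg-involutive (+ K))) (ℤ.i≤j⇒0≤j-i -K≤v))
      i<K+K : + ∣ v + + K ∣ < + K + + K
      i<K+K = subst (_< + K + + K) (sym i≡v+K) (ℤ.+-monoˡ-< (+ K) v<K)
      cancel : ∀ a k → a + k - k ≡ a
      cancel = solve-∀

    slot-window : ∀ i → i ℕ.< K ℕ.+ K → InWindow (slot i)
    slot-window i i<2K = ℤ.i≤j+i (- + K) (+ i) , subst (slot i <_) (cancel (+ K)) (ℤ.+-monoˡ-< (- + K) (+<+ i<2K))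
      where
      cancel : ∀ k → k + k - k ≡ k
      cancel = solve-∀

    ∑-slots-at : ∀ v → InWindow v → ∑[ i < K ℕ.+ K ] 𝟙 (v ≟ slot i) ≡ 1
    ∑-slots-at v v∈W = hit (slot-onto v v∈W)
      where
      hit : ∃[ i₀ ] i₀ ℕ.< K ℕ.+ K × slot i₀ ≡ v → ∑[ i < K ℕ.+ K ] 𝟙 (v ≟ slot i) ≡ 1
      hit (i₀ , i₀<2K , slot≡v) = ∑<-single (K ℕ.+ K) (λ i → 𝟙 (v ≟ slot i)) i₀ i₀<2K
        (𝟙≡1 (v ≟ slot i₀) (sym slot≡v))
        (λ i _ i≢i₀ → 𝟙≡0 (v ≟ slot i) (λ v≡slot → i≢i₀ (slot-injective (sym v≡slot ⟨ trans ⟩ sym slot≡v))))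

    inClassUpTo : ℤ → ℤ → ℤ → ℕ
    inClassUpTo c X n = 𝟙 (+ s ∣? n - c) ℕ.* 𝟙 (n ≤? X)

    countUpTo : ℤ → ℤ → ℕ
    countUpTo c X = ∑[ i < K ℕ.+ K ] inClassUpTo c X (slot i)

    private
      -- distinct members of a residue class are at least s apart
      class-gap : ∀ c X n → + s ∣ X - c → + s ∣ n - c → n ≤ X + + s → X + + s ≢ n → n ≤ X
      class-gap c X n s∣X-c s∣n-c n≤X+s X+s≢n = ≤-by-difference (X + + s - n - + s)
        (ℤ.i≤j⇒0≤j-i (multiple-≥ s s∣gap (ℤ.i≤j⇒0≤j-i n≤X+s) (λ gap≡0 → X+s≢n (ℤ.i-j≡0⇒i≡j _ _ gap≡0))))
        (shift X n (+ s))
        where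
        shift : ∀ X n s → X - n ≡ X + s - n - s
        shift = solve-∀
        s∣gap : + s ∣ X + + s - n
        s∣gap = subst (+ s ∣_) (cancel (X + + s) n c) (∣m∣n⇒∣m-n (class-+s s c X s∣X-c) s∣n-c)
          where
          cancel : ∀ a n c → (a - c) - (n - c) ≡ a - n
          cancel = solve-∀

    inClassUpTo-step : ∀ c X n → + s ∣ X - c →
                      inClassUpTo c (X + + s) n ≡ inClassUpTo c X n ℕ.+ 𝟙 (X + + s ≟ n)
    inClassUpTo-step c X n s∣X-c with + s ∣? n - c | X + + s ≟ n
    ... | no s∤n-c | yes refl = contradiction (class-+s s c X s∣X-c) s∤n-c
    ... | no _     | no _     = refl
    ... | yes _    | yes refl with (X + + s) ≤? (X + + s) | (X + + s) ≤? X
    ...   | yes _ | no _      = refl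
    ...   | no ≰  | _         = contradiction ℤ.≤-refl ≰
    ...   | yes _ | yes X+s≤X = contradiction X+s≤X (ℤ.<⇒≱ (<+nonZero s X))
    inClassUpTo-step c X n s∣X-c | yes s∣n-c | no X+s≢n with n ≤? X + + s | n ≤? X
    ... | yes _       | yes _   = refl
    ... | no _        | no _    = refl
    ... | yes n≤X+s   | no n≰X  = contradiction (class-gap c X n s∣X-c s∣n-c n≤X+s X+s≢n) n≰X
    ... | no n≰X+s    | yes n≤X = contradiction (ℤ.≤-trans n≤X (ℤ.<⇒≤ (<+nonZero s X))) n≰X+s

    countUpTo-step : ∀ c X → + s ∣ X - c → InWindow (X + + s) → countUpTo c (X + + s) ≡ countUpTo c X ℕ.+ 1
    countUpTo-step c X s∣X-c X+s∈W = begin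
      countUpTo c (X + + s)
        ≡⟨ ∑<-cong (K ℕ.+ K) (λ i _ → inClassUpTo-step c X (slot i) s∣X-c) ⟩
      ∑[ i < K ℕ.+ K ] (inClassUpTo c X (slot i) ℕ.+ 𝟙 (X + + s ≟ slot i))
        ≡⟨ ∑<-+ (K ℕ.+ K) (λ i → inClassUpTo c X (slot i)) (λ i → 𝟙 (X + + s ≟ slot i)) ⟩
      countUpTo c X ℕ.+ ∑[ i < K ℕ.+ K ] 𝟙 (X + + s ≟ slot i)
        ≡⟨ cong (countUpTo c X ℕ.+_) (∑-slots-at (X + + s) X+s∈W) ⟩
      countUpTo c X ℕ.+ 1 ∎
      where open ≡-Reasoning

    countUpTo-progression : ∀ c X m → + s ∣ X - c → - + K ≤ X + + s → X + + (m ℕ.* s) < + K →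
                     countUpTo c (X + + (m ℕ.* s)) ≡ countUpTo c X ℕ.+ m
    countUpTo-progression c X zero    _     _   _    = cong (countUpTo c) (ℤ.+-identityʳ X) ⟨ trans ⟩ sym (ℕ.+-identityʳ _)
    countUpTo-progression c X (suc m) s∣X-c low high = begin
      countUpTo c (X + + (suc m ℕ.* s))  ≡⟨ cong (countUpTo c) Y+s≡ ⟨
      countUpTo c (Y + + s)              ≡⟨ countUpTo-step c Y s∣Y-c (low′ , subst (_< + K) (sym Y+s≡) high) ⟩
      countUpTo c Y ℕ.+ 1                ≡⟨ cong (ℕ._+ 1) (countUpTo-progression c X m s∣X-c low (ℤ.<-trans (<+nonZero s Y) Y+s<K)) ⟩
      countUpTo c X ℕ.+ m ℕ.+ 1          ≡⟨ trans (ℕ.+-assoc _ m 1) (cong (countUpTo c X ℕ.+_) (ℕ.+-comm m 1)) ⟩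
      countUpTo c X ℕ.+ suc m            ∎
      where
      open ≡-Reasoning
      Y : ℤ
      Y = X + + (m ℕ.* s)
      Y+s≡ : Y + + s ≡ X + + (suc m ℕ.* s)
      Y+s≡ = rearrange X (+ s) (+ (m ℕ.* s)) ⟨ trans ⟩ cong (λ k → X + k) (sym (ℤ.pos-+ s (m ℕ.* s)))
        where
        rearrange : ∀ x a b → x + b + a ≡ x + (a + b)
        rearrange = solve-∀
      Y+s<K : Y + + s < + K
      Y+s<K = subst (_< + K) (sym Y+s≡) high
      s∣Y-c : + s ∣ Y - c
      s∣Y-c = subst (+ s ∣_) (rearrange X c (+ (m ℕ.* s)))
                (∣m∣n⇒∣m+n s∣X-c (divides (+ m) (ℤ.pos-* m s)))
        where
        rearrange : ∀ x c a → (x - c) + a ≡ (x + a) - c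
        rearrange = solve-∀
      low′ : - + K ≤ Y + + s
      low′ = ℤ.≤-trans low (≤-by-difference (+ (m ℕ.* s)) (+≤+ z≤n) (rearrange X (+ s) (+ (m ℕ.* s))))
        where
        rearrange : ∀ x s a → x + a + s - (x + s) ≡ a
        rearrange = solve-∀

    private

      countUpTo-difference-≤ : ∀ c X Y → + s ∣ X - c → + s ∣ Y - c → - + K ≤ X + + s → Y < + K → X ≤ Y →
                        (+ countUpTo c Y - + countUpTo c X) * + s ≡ Y - X
      countUpTo-difference-≤ c X Y s∣X-c s∣Y-c low high X≤Y
        with nonneg-multiple s (∣m∣n⇒∣m-n s∣Y-c s∣X-c) (subst (0ℤ ≤_) (sym (cancel-class Y X c)) (ℤ.i≤j⇒0≤j-i X≤Y))
      ... | m , Y-c-[X-c]≡ms = begin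
        (+ countUpTo c Y - + countUpTo c X) * + s                 ≡⟨ cong (λ n → (+ countUpTo c n - + countUpTo c X) * + s) Y≡X+ms ⟩
        (+ countUpTo c (X + + (m ℕ.* s)) - + countUpTo c X) * + s ≡⟨ cong (λ n → (+ n - + countUpTo c X) * + s)
                                                          (countUpTo-progression c X m s∣X-c low (subst (_< + K) Y≡X+ms high)) ⟩
        (+ (countUpTo c X ℕ.+ m) - + countUpTo c X) * + s         ≡⟨ cancel (+ countUpTo c X) (+ m) (+ s) ⟩
        + m * + s                                   ≡⟨ ℤ.pos-* m s ⟨
        + (m ℕ.* s)                                 ≡⟨ Y-c-[X-c]≡ms ⟨
        (Y - c) - (X - c)                           ≡⟨ cancel-class Y X c ⟩
        Y - X                                       ∎
        where
        open ≡-Reasoning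
        cancel : ∀ a m s → (a + m - a) * s ≡ m * s
        cancel = solve-∀
        Y≡X+ms : Y ≡ X + + (m ℕ.* s)
        Y≡X+ms = solve-Y Y X c (+ (m ℕ.* s)) Y-c-[X-c]≡ms
          where
          solve-Y : ∀ y x c a → (y - c) - (x - c) ≡ a → y ≡ x + a
          solve-Y y x c a eq = shift y x c ⟨ trans ⟩ cong (λ k → x + k) eq
            where
            shift : ∀ y x c → y ≡ x + ((y - c) - (x - c))
            shift = solve-∀

    countUpTo-difference : ∀ c X Y → + s ∣ X - c → + s ∣ Y - c →
                    - + K ≤ X + + s → - + K ≤ Y + + s → X < + K → Y < + K →
                    (+ countUpTo c X - + countUpTo c Y) * + s ≡ X - Y
    countUpTo-difference c X Y s∣X-c s∣Y-c lowX lowY highX highY with ℤ.≤-total X Y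
    ... | inj₂ Y≤X = countUpTo-difference-≤ c Y X s∣Y-c s∣X-c lowY highX Y≤X
    ... | inj₁ X≤Y = negate (+ countUpTo c X) (+ countUpTo c Y) (+ s) X Y (countUpTo-difference-≤ c X Y s∣X-c s∣Y-c lowX highY X≤Y)
      where
      negate : ∀ a b s x y → (b - a) * s ≡ y - x → (a - b) * s ≡ x - y
      negate a b s x y eq = flip a b s ⟨ trans ⟩ cong -_ eq ⟨ trans ⟩ flip′ y x
        where
        flip : ∀ a b s → (a - b) * s ≡ - ((b - a) * s)
        flip = solve-∀
        flip′ : ∀ y x → - (y - x) ≡ x - y
        flip′ = solve-∀

  module Beads (s K : ℕ) .{{_ : NonZero s}} (lam : Partition) (closed : Closed s lam)
               (length≤K : length (parts lam) ℕ.≤ K) (λ₁≤K : part lam 0 ℕ.≤ K)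
               (M : ℤ → ℤ) (isMax : ∀ c → IsClassMax s lam c (M c)) where

    open Window s K

    β : ℕ → ℤ
    β r = + part lam r - + suc r

    private
      part≤K : ∀ r → part lam r ℕ.≤ K
      part≤K r = ℕ.≤-trans (part-antitone lam z≤n) λ₁≤K

      part≡0 : ∀ r → K ℕ.≤ r → part lam r ≡ 0
      part≡0 r K≤r = partL-≥length (parts lam) r (ℕ.≤-trans length≤K K≤r)

    β<K : ∀ r → β r < + K
    β<K r = ℤ.<-≤-trans (subst (β r <_) (ℤ.+-identityʳ _) (ℤ.+-monoʳ-< (+ part lam r) -<+)) (+≤+ (part≤K r))

    β-window : ∀ r → r ℕ.< K → InWindow (β r)
    β-window r r<K = ℤ.≤-trans (ℤ.neg-mono-≤ (+≤+ r<K)) (ℤ.i≤j+i (- + suc r) (+ part lam r)) , β<K r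

    β-beyond : ∀ r → K ℕ.≤ r → β r < - + K
    β-beyond r K≤r rewrite part≡0 r K≤r = subst (_< - + K) (sym (ℤ.+-identityˡ _)) (ℤ.neg-mono-< (+<+ (s≤s K≤r)))

    β-decreasing : ∀ {r r′} → r ℕ.< r′ → β r′ < β r
    β-decreasing r<r′ = ℤ.+-mono-≤-< (+≤+ (part-antitone lam (ℕ.<⇒≤ r<r′))) (ℤ.neg-mono-< (+<+ (s≤s r<r′)))

    β-injective : ∀ {r r′} → β r ≡ β r′ → r ≡ r′
    β-injective {r} {r′} eq with ℕ.<-cmp r r′
    ... | tri< r<r′ _ _ = contradiction (sym eq) (ℤ.<⇒≢ (β-decreasing r<r′))
    ... | tri≈ _ r≡r′ _ = r≡r′
    ... | tri> _ _ r′<r = contradiction eq (ℤ.<⇒≢ (β-decreasing r′<r))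

    ∈B-below-window : ∀ v → v < - + K → v ∈B lam
    ∈B-below-window (+ n)    v<-K = contradiction (ℤ.<-≤-trans v<-K ℤ.neg-≤-pos) (ℤ.<-irrefl refl)
    ∈B-below-window -[1+ n ] v<-K = n , sym (cong (_- + suc n) (cong +_ (part≡0 n K≤n)) ⟨ trans ⟩ ℤ.+-identityˡ _)
      where
      K≤n : K ℕ.≤ n
      K≤n = ℕ.≤-pred (ℤ.drop‿+<+ (ℤ.neg-cancel-< v<-K))

    beads : ℤ → ℕ
    beads v = ∑[ r < K ] 𝟙 (β r ≟ v)

    ∑-beads : ∑[ i < K ℕ.+ K ] beads (slot i) ≡ K
    ∑-beads = begin
      ∑[ i < K ℕ.+ K ] ∑[ r < K ] 𝟙 (β r ≟ slot i) ≡⟨ ∑<-comm (K ℕ.+ K) K (λ i r → 𝟙 (β r ≟ slot i)) ⟩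
      ∑[ r < K ] ∑[ i < K ℕ.+ K ] 𝟙 (β r ≟ slot i) ≡⟨ ∑<-cong K (λ r r<K → ∑-slots-at (β r) (β-window r r<K)) ⟩
      ∑[ r < K ] 1                                 ≡⟨ ∑<-ones K ⟩
      K                                            ∎
      where open ≡-Reasoning

    M<K : ∀ c → M c < + K
    M<K c with max-∈B lam (isMax c)
    ... | r , Mc≡βr = subst (_< + K) (sym Mc≡βr) (β<K r)

    -- every number below the window is a beta number, so a class maximum cannot lie that low
    -K≤M+s : ∀ c → - + K ≤ M c + + s
    -K≤M+s c = ℤ.≮⇒≥ λ M+s<-K → ℤ.<⇒≱ (<+nonZero s (M c))
      (max-greatest lam (isMax c) (M c + + s) (∈B-below-window _ M+s<-K) (class-+s s c (M c) (max-class lam (isMax c))))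

    private
      beads-present : ∀ n → InWindow n → n ∈B lam → beads n ≡ 1
      beads-present n (-K≤n , _) (r₀ , n≡βr₀) = ∑<-single K (λ r → 𝟙 (β r ≟ n)) r₀ r₀<K
          (𝟙≡1 (β r₀ ≟ n) (sym n≡βr₀))
          (λ r _ r≢r₀ → 𝟙≡0 (β r ≟ n) (λ βr≡n → r≢r₀ (β-injective (βr≡n ⟨ trans ⟩ n≡βr₀))))
        where
        r₀<K : r₀ ℕ.< K
        r₀<K = ℕ.≰⇒> λ K≤r₀ → ℤ.<⇒≱ (β-beyond r₀ K≤r₀) (subst (- + K ≤_) n≡βr₀ -K≤n)

      beads-absent : ∀ n → ¬ n ∈B lam → beads n ≡ 0
      beads-absent n n∉B = ∑<-zero K (λ r → 𝟙 (β r ≟ n)) (λ r _ → 𝟙≡0 (β r ≟ n) (λ βr≡n → n∉B (r , sym βr≡n)))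

    beads-in-class : ∀ c n → InWindow n → + s ∣ n - c → beads n ≡ 𝟙 (n ≤? M c)
    beads-in-class c n n∈W s∣n-c with n ≤? M c
    ... | yes n≤M = beads-present n n∈W (below-max lam closed (isMax c) n s∣n-c n≤M)
    ... | no n≰M  = beads-absent n (λ n∈B → n≰M (max-greatest lam (isMax c) n n∈B s∣n-c))

    countUpTo-max : ∀ c → countUpTo c (M c) ≡ ∑[ i < K ℕ.+ K ] (𝟙 (+ s ∣? slot i - c) ℕ.* beads (slot i))
    countUpTo-max c = ∑<-cong (K ℕ.+ K) pointwise
      where
      pointwise : ∀ i → i ℕ.< K ℕ.+ K → inClassUpTo c (M c) (slot i) ≡ 𝟙 (+ s ∣? slot i - c) ℕ.* beads (slot i)
      pointwise i i<2K with + s ∣? slot i - c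
      ... | no _      = refl
      ... | yes s∣i-c = cong (1 ℕ.*_) (sym (beads-in-class c (slot i) (slot-window i i<2K) s∣i-c))

    ∑-countUpTo-max : ∀ t → Coprime s t → ∑[ j < s ] countUpTo (+ (j ℕ.* t)) (M (+ (j ℕ.* t))) ≡ K
    ∑-countUpTo-max t coprime = begin
      ∑[ j < s ] countUpTo (c j) (M (c j))
        ≡⟨ ∑<-cong s (λ j _ → countUpTo-max (c j)) ⟩
      ∑[ j < s ] ∑[ i < K ℕ.+ K ] (𝟙 (+ s ∣? slot i - c j) ℕ.* beads (slot i))
        ≡⟨ ∑<-comm s (K ℕ.+ K) (λ j i → 𝟙 (+ s ∣? slot i - c j) ℕ.* beads (slot i)) ⟩
      ∑[ i < K ℕ.+ K ] ∑[ j < s ] (𝟙 (+ s ∣? slot i - c j) ℕ.* beads (slot i))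
        ≡⟨ ∑<-cong (K ℕ.+ K) (λ i _ → ∑<-*ʳ s (λ j → 𝟙 (+ s ∣? slot i - c j)) (beads (slot i))) ⟩
      ∑[ i < K ℕ.+ K ] ((∑[ j < s ] 𝟙 (+ s ∣? slot i - c j)) ℕ.* beads (slot i))
        ≡⟨ ∑<-cong (K ℕ.+ K) (λ i _ → cong (ℕ._* beads (slot i)) (Residues.∑-residues s t coprime (slot i))
                                       ⟨ trans ⟩ ℕ.*-identityˡ (beads (slot i))) ⟩
      ∑[ i < K ℕ.+ K ] beads (slot i)
        ≡⟨ ∑-beads ⟩
      K ∎
      where
      open ≡-Reasoning
      c : ℕ → ℤ
      c j = + (j ℕ.* t)

module PinchPoints where

  open import Data.Nat as ℕ using (ℕ; suc; NonZero)
  import Data.Nat.Properties as ℕ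
  open import Data.Nat.Coprimality using (Coprime)
  open import Data.Integer using (ℤ; +_; -[1+_]; _+_; _-_; _*_; -_; _≤_; 0ℤ)
  import Data.Integer.Properties as ℤ
  open import Data.Integer.Divisibility.Signed using (_∣_; divides)
  open import Data.Integer.Tactic.RingSolver using (solve-∀)
  open import Data.Product using (∃-syntax; _×_; _,_)
  open import Data.Sum using (_⊎_; inj₁; inj₂)
  open import Relation.Binary.PropositionalEquality
  open import Function.Base using (_⟨_⟩_)
  open CoreClosure
  open ResidueClasses using (module Residues)

  module Pinch (s t : ℕ) .{{_ : NonZero s}} (lam : Partition) (x : ℤ) (coprime : Coprime s t)
               (closed-s : Closed s lam) (closed-t : Closed t lam) (x∈B : x ∈B lam)
               (class-bound : ∀ z → z ∈B lam → + s ∣ z - (x + + t) → z ≤ x + + t) where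

    L⊆B : ∀ z → InL s t x z → z ∈B lam
    L⊆B z (a , b , z≡) = subst (_∈B lam) (sym z≡)
      (closed-multiple {t} {lam} closed-t b _ (closed-multiple {s} {lam} closed-s a x x∈B))

    -- stepping down from z by the remaining s − 1 − j multiples of t lands in the class of x + t,
    -- whose members are at most x + t; this bounds a = suc n by t
    ∈R : ∀ z j n → j ℕ.< s → z ∈B lam → z ≡ x + + (suc n ℕ.* s) - + (j ℕ.* t) → InR s t x z
    ∈R z j n j<s z∈B z≡ = suc n , j , ℕ.s≤s ℕ.z≤n , a≤t , j<s , z≡
      where
      a e : ℕ
      a = suc n
      e = s ℕ.∸ suc j
      e+1+j≡s : + e + (+ 1 + + j) ≡ + s
      e+1+j≡s = cong +_ (ℕ.m∸n+n≡m j<s)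
      z′≡ : z - + (e ℕ.* t) ≡ (x + + t) + + (a ℕ.* s) - + s * + t
      z′≡ = begin
        z - + (e ℕ.* t)                                            ≡⟨ cong₂ (λ u v → u - v) z≡ (ℤ.pos-* e t) ⟩
        x + + (a ℕ.* s) - + (j ℕ.* t) - + e * + t                  ≡⟨ cong (λ v → x + + (a ℕ.* s) - v - + e * + t) (ℤ.pos-* j t) ⟩
        x + + (a ℕ.* s) - + j * + t - + e * + t                    ≡⟨ regroup x (+ (a ℕ.* s)) (+ j) (+ e) (+ t) ⟩
        (x + + t) + + (a ℕ.* s) - (+ e + (+ 1 + + j)) * + t        ≡⟨ cong (λ v → (x + + t) + + (a ℕ.* s) - v * + t) e+1+j≡s ⟩
        (x + + t) + + (a ℕ.* s) - + s * + t                        ∎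
        where
        open ≡-Reasoning
        regroup : ∀ x A J E T → x + A - J * T - E * T ≡ (x + T) + A - (E + (+ 1 + J)) * T
        regroup = solve-∀
      z′-bound : z - + (e ℕ.* t) ≤ x + + t
      z′-bound = class-bound _ (closed-multiple {t} {lam} closed-t e z z∈B) (divides (+ a - + t) (begin
        z - + (e ℕ.* t) - (x + + t)                          ≡⟨ cong (_- (x + + t)) z′≡ ⟩
        (x + + t) + + (a ℕ.* s) - + s * + t - (x + + t)      ≡⟨ cong (λ v → (x + + t) + v - + s * + t - (x + + t)) (ℤ.pos-* a s) ⟩
        (x + + t) + + a * + s - + s * + t - (x + + t)        ≡⟨ factor (x + + t) (+ a) (+ s) (+ t) ⟩
        (+ a - + t) * + s                                    ∎))
        where
        open ≡-Reasoning
        factor : ∀ y a s t → y + a * s - s * t - y ≡ (a - t) * s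
        factor = solve-∀
      a≤t : a ℕ.≤ t
      a≤t = ℕ.*-cancelʳ-≤ a t s (ℤ.drop‿+≤+ (ℤ.0≤i-j⇒j≤i (subst (0ℤ ≤_) gap (ℤ.i≤j⇒0≤j-i z′-bound))))
        where
        gap : (x + + t) - (z - + (e ℕ.* t)) ≡ + (t ℕ.* s) - + (a ℕ.* s)
        gap = cong (λ v → (x + + t) - v) z′≡ ⟨ trans ⟩ cancel (x + + t) (+ (a ℕ.* s)) (+ s) (+ t)
              ⟨ trans ⟩ cong (_- + (a ℕ.* s)) (sym (ℤ.pos-* t s))
          where
          cancel : ∀ y A s t → y - (y + A - s * t) ≡ t * s - A
          cancel = solve-∀

    B⊆L∪R : ∀ z → z ∈B lam → InL s t x z ⊎ InR s t x z
    B⊆L∪R z z∈B = classify (Residues.residue s t coprime (x - z))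
      where
      classify : ∃[ j ] j ℕ.< s × + s ∣ x - z - + (j ℕ.* t) → InL s t x z ⊎ InR s t x z
      classify (j , j<s , divides k x-z-jt≡ks) = split k (isolate x z (+ (j ℕ.* t)) k (+ s) x-z-jt≡ks)
        where
        isolate : ∀ x z jt k s → x - z - jt ≡ k * s → z ≡ x - k * s - jt
        isolate x z jt k s eq = shift x z jt ⟨ trans ⟩ cong (λ v → x - v - jt) eq
          where
          shift : ∀ x z jt → z ≡ x - (x - z - jt) - jt
          shift = solve-∀
        split : ∀ k → z ≡ x - k * + s - + (j ℕ.* t) → InL s t x z ⊎ InR s t x z
        split (+ n)    z≡ = inj₁ (n , j , (z≡ ⟨ trans ⟩ cong (λ v → x - v - + (j ℕ.* t)) (sym (ℤ.pos-* n s))))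
        split -[1+ n ] z≡ = inj₂ (∈R z j n j<s z∈B (z≡ ⟨ trans ⟩ flip x (+ suc n) (+ s) (+ (j ℕ.* t))
                                                       ⟨ trans ⟩ cong (λ v → x + v - + (j ℕ.* t)) (sym (ℤ.pos-* (suc n) s))))
          where
          flip : ∀ x a s jt → x - (- a) * s - jt ≡ x + a * s - jt
          flip = solve-∀

    pinch-point : PinchPoint s t lam x
    pinch-point = L⊆B , B⊆L∪R

module Peaks where

  open import Data.Nat as ℕ using (ℕ; zero; suc; NonZero)
  import Data.Nat.Properties as ℕ
  open import Data.Nat.Coprimality using (Coprime)
  open import Data.Integer using (ℤ; +_; _+_; _-_; _*_; -_; _≤_; 0ℤ; ∣_∣)
  import Data.Integer.Properties as ℤ
  open import Data.Integer.Divisibility.Signed using (_∣_; divides; ∣m∣n⇒∣m+n; ∣m∣n⇒∣m-n)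
  open import Data.Integer.Tactic.RingSolver using (solve-∀)
  open import Data.List using (length)
  open import Data.Product using (_,_)
  open import Relation.Nullary using (yes; no)
  open import Relation.Binary.PropositionalEquality
  open import Function.Base using (_⟨_⟩_)
  open Sums
  open CoreClosure
  open Abacus

  module Peak (s t : ℕ) .{{_ : NonZero s}} (coprime : Coprime s t) (σ τ : Partition)
              (σ-closed : Closed s σ) (τ-closed : Closed s τ)
              (Mσ Mτ δ : ℤ → ℤ)
              (σ-max : ∀ a → IsClassMax s σ a (Mσ a)) (τ-max : ∀ a → IsClassMax s τ a (Mτ a))
              (δ-def : ∀ a → + s * δ a ≡ Mσ a - Mτ a) where

    private
      c : ℕ → ℤ
      c j = + (j ℕ.* t)

      S : ℕ → ℤ
      S = sumUpTo δ t

      L P K : ℕ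
      L = length (parts σ) ℕ.+ length (parts τ)
      P = part σ 0 ℕ.+ part τ 0
      K = L ℕ.+ P

      module Bσ = Beads s K σ σ-closed
        (ℕ.≤-trans (ℕ.m≤m+n (length (parts σ)) _) (ℕ.m≤m+n L P))
        (ℕ.≤-trans (ℕ.m≤m+n (part σ 0) _) (ℕ.m≤n+m P L)) Mσ σ-max
      module Bτ = Beads s K τ τ-closed
        (ℕ.≤-trans (ℕ.m≤n+m (length (parts τ)) _) (ℕ.m≤m+n L P))
        (ℕ.≤-trans (ℕ.m≤n+m (part τ 0) _) (ℕ.m≤n+m P L)) Mτ τ-max
      open Window s K

      beadsσ beadsτ : ℕ → ℕ
      beadsσ j = countUpTo (c j) (Mσ (c j))
      beadsτ j = countUpTo (c j) (Mτ (c j))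

      δ-by-beads : ∀ j → + s * δ (c j) ≡ (+ beadsσ j - + beadsτ j) * + s
      δ-by-beads j = δ-def (c j) ⟨ trans ⟩ sym (countUpTo-difference (c j) (Mσ (c j)) (Mτ (c j))
        (max-class σ (σ-max (c j))) (max-class τ (τ-max (c j)))
        (Bσ.-K≤M+s (c j)) (Bτ.-K≤M+s (c j)) (Bσ.M<K (c j)) (Bτ.M<K (c j)))

      S-by-beads : ∀ n → + s * S n ≡ (+ ∑< (suc n) beadsσ - + ∑< (suc n) beadsτ) * + s
      S-by-beads zero    = δ-by-beads 0
      S-by-beads (suc n) = begin
        + s * (S n + δ (c (suc n)))                    ≡⟨ ℤ.*-distribˡ-+ (+ s) (S n) (δ (c (suc n))) ⟩
        + s * S n + + s * δ (c (suc n))                ≡⟨ cong₂ _+_ (S-by-beads n) (δ-by-beads (suc n)) ⟩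
        (A - B) * + s + (+ beadsσ (suc n) - + beadsτ (suc n)) * + s
                                                       ≡⟨ collect A B (+ beadsσ (suc n)) (+ beadsτ (suc n)) (+ s) ⟩
        ((A + + beadsσ (suc n)) - (B + + beadsτ (suc n))) * + s ∎
        where
        open ≡-Reasoning
        A B : ℤ
        A = + ∑< (suc n) beadsσ
        B = + ∑< (suc n) beadsτ
        collect : ∀ A B a b s → (A - B) * s + (a - b) * s ≡ ((A + a) - (B + b)) * s
        collect = solve-∀

    -- σ and τ both have K beads in the window, and 0, t, …, (s − 1) t meet every class mod s once
    S-total : S (ℕ.pred s) ≡ 0ℤ
    S-total = ℤ.*-cancelˡ-≡ (+ s) (S (ℕ.pred s)) 0ℤ (begin
      + s * S (ℕ.pred s)                               ≡⟨ S-by-beads (ℕ.pred s) ⟩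
      (+ ∑< (suc (ℕ.pred s)) beadsσ - + ∑< (suc (ℕ.pred s)) beadsτ) * + s
                                                       ≡⟨ cong (λ n → (+ ∑< n beadsσ - + ∑< n beadsτ) * + s) (ℕ.suc-pred s) ⟩
      (+ ∑< s beadsσ - + ∑< s beadsτ) * + s            ≡⟨ cong₂ (λ a b → (+ a - + b) * + s) (Bσ.∑-countUpTo-max t coprime) (Bτ.∑-countUpTo-max t coprime) ⟩
      (+ K - + K) * + s                                ≡⟨ vanish (+ K) (+ s) ⟩
      + s * 0ℤ                                         ∎)
      where
      open ≡-Reasoning
      vanish : ∀ k s → (k - k) * s ≡ s * 0ℤ
      vanish = solve-∀

    Maximal : ℕ → Set
    Maximal k = ∀ k′ → k′ ℕ.< s → S k′ ≤ S k

    private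
      pred<s : ℕ.pred s ℕ.< s
      pred<s = ℕ.≤-reflexive (ℕ.suc-pred s)

      increment-nonneg : ∀ a d → a ≤ a + d → 0ℤ ≤ d
      increment-nonneg a d a≤a+d = subst (0ℤ ≤_) (cancel a d) (ℤ.i≤j⇒0≤j-i a≤a+d)
        where
        cancel : ∀ a d → a + d - a ≡ d
        cancel = solve-∀

      increment-nonpos : ∀ a d → a + d ≤ a → d ≤ 0ℤ
      increment-nonpos a d a+d≤a = subst (_≤ 0ℤ) (cancel a d) (ℤ.i≤j⇒i-j≤0 a+d≤a)
        where
        cancel : ∀ a d → a + d - a ≡ d
        cancel = solve-∀

      δ-periodic : δ (c s) ≡ δ (c 0)
      δ-periodic = ℤ.*-cancelˡ-≡ (+ s) (δ (c s)) (δ (c 0)) (begin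
        + s * δ (c s)        ≡⟨ δ-def (c s) ⟩
        Mσ (c s) - Mτ (c s)  ≡⟨ cong₂ _-_ (max-unique σ {c s} {c 0} (σ-max (c s)) (σ-max (c 0)) s∣st)
                                            (max-unique τ {c s} {c 0} (τ-max (c s)) (τ-max (c 0)) s∣st) ⟩
        Mσ (c 0) - Mτ (c 0)  ≡⟨ δ-def (c 0) ⟨
        + s * δ (c 0)        ∎)
        where
        open ≡-Reasoning
        s∣st : + s ∣ c s - c 0
        s∣st = divides (+ t) (ℤ.+-identityʳ (c s) ⟨ trans ⟩ ℤ.pos-* s t ⟨ trans ⟩ ℤ.*-comm (+ s) (+ t))

      δ-at-end : ∀ k → suc k ≡ s → Maximal k → δ (c (suc k)) ≤ 0ℤ
      δ-at-end k refl maximal = subst (_≤ 0ℤ) (sym δ-periodic) (subst (S 0 ≤_) S-total (maximal 0 (ℕ.>-nonZero⁻¹ s)))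

    δ-at-peak : ∀ k → k ℕ.< s → Maximal k → 0ℤ ≤ δ (c k)
    δ-at-peak zero    _     maximal = subst (_≤ S 0) S-total (maximal (ℕ.pred s) pred<s)
    δ-at-peak (suc k) 1+k<s maximal = increment-nonneg (S k) (δ (c (suc k))) (maximal k (ℕ.<-trans (ℕ.n<1+n k) 1+k<s))

    δ-after-peak : ∀ k → k ℕ.< s → Maximal k → δ (c (suc k)) ≤ 0ℤ
    δ-after-peak k k<s maximal with suc k ℕ.<? s
    ... | yes 1+k<s = increment-nonpos (S k) (δ (c (suc k))) (maximal (suc k) 1+k<s)
    ... | no 1+k≮s  = δ-at-end k (ℕ.≤-antisym k<s (ℕ.≮⇒≥ 1+k≮s)) maximal

    module AtPeak (k : ℕ) (k<s : k ℕ.< s) (maximal : Maximal k) (x : ℤ) (x≡ : x ≡ Mτ (c k))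
                  (τ-closed-t : Closed t τ) where

      private
        s∣x-ck : + s ∣ x - c k
        s∣x-ck = subst (λ y → + s ∣ y - c k) (sym x≡) (max-class τ (τ-max (c k)))

        -- c (suc k) is t + c k, so the class of x + t is that of (k + 1) t
        shift-class : ∀ z → + s ∣ z - (x + + t) → + s ∣ (z - + t) - c k
        shift-class z s∣z-x-t = subst (+ s ∣_) (regroup z x (+ t) (c k)) (∣m∣n⇒∣m+n s∣z-x-t s∣x-ck)
          where
          regroup : ∀ z x t ck → (z - (x + t)) + (x - ck) ≡ (z - t) - ck
          regroup = solve-∀

        next-class : ∀ z → + s ∣ z - (x + + t) → + s ∣ z - c (suc k)
        next-class z s∣z-x-t = subst (+ s ∣_) (regroup z (+ t) (c k)) (shift-class z s∣z-x-t)
          where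
          regroup : ∀ z t ck → (z - t) - ck ≡ z - (t + ck)
          regroup = solve-∀

        into-class : ∀ z → + s ∣ z - c (suc k) → + s ∣ z - (x + + t)
        into-class z s∣z-c = subst (+ s ∣_) (regroup z x (+ t) (c k)) (∣m∣n⇒∣m-n s∣z-c s∣x-ck)
          where
          regroup : ∀ z x t ck → (z - (t + ck)) - (x - ck) ≡ z - (x + t)
          regroup = solve-∀

      x∈Bτ : x ∈B τ
      x∈Bτ = subst (_∈B τ) (sym x≡) (max-∈B τ (τ-max (c k)))

      x∈Bσ : x ∈B σ
      x∈Bσ = subst (_∈B σ) lands (closed-multiple {s} {σ} σ-closed ∣ δ (c k) ∣ (Mσ (c k)) (max-∈B σ (σ-max (c k))))
        where
        open ≡-Reasoning
        lands : Mσ (c k) - + (∣ δ (c k) ∣ ℕ.* s) ≡ x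
        lands = begin
          Mσ (c k) - + (∣ δ (c k) ∣ ℕ.* s)  ≡⟨ cong (λ d → Mσ (c k) - d)
                                                   (ℤ.pos-* ∣ δ (c k) ∣ s ⟨ trans ⟩ cong (_* + s) (ℤ.0≤i⇒+∣i∣≡i (δ-at-peak k k<s maximal))
                                                    ⟨ trans ⟩ ℤ.*-comm (δ (c k)) (+ s)) ⟩
          Mσ (c k) - + s * δ (c k)          ≡⟨ cong (λ d → Mσ (c k) - d) (δ-def (c k)) ⟩
          Mσ (c k) - (Mσ (c k) - Mτ (c k))  ≡⟨ cancel (Mσ (c k)) (Mτ (c k)) ⟩
          Mτ (c k)                          ≡⟨ x≡ ⟨
          x                                 ∎
          where
          cancel : ∀ a b → a - (a - b) ≡ b
          cancel = solve-∀

      τ-bound : ∀ z → z ∈B τ → + s ∣ z - (x + + t) → z ≤ x + + t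
      τ-bound z z∈B s∣z-x-t = subst (_≤ x + + t) (cancel z (+ t)) (ℤ.+-monoˡ-≤ (+ t) z-t≤x)
        where
        z-t≤x : z - + t ≤ x
        z-t≤x = subst (z - + t ≤_) (sym x≡)
                  (max-greatest τ (τ-max (c k)) (z - + t) (τ-closed-t z z∈B) (shift-class z s∣z-x-t))
        cancel : ∀ z t → z - t + t ≡ z
        cancel = solve-∀

      σ-bound : ∀ z → z ∈B σ → + s ∣ z - (x + + t) → z ≤ x + + t
      σ-bound z z∈B s∣z-x-t = begin
        z                  ≤⟨ max-greatest σ (σ-max c₁) z z∈B (next-class z s∣z-x-t) ⟩
        Mσ c₁              ≤⟨ ℤ.i-j≤0⇒i≤j (subst (_≤ 0ℤ) (δ-def c₁) s*δ≤0) ⟩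
        Mτ c₁              ≤⟨ τ-bound (Mτ c₁) (max-∈B τ (τ-max c₁)) (into-class (Mτ c₁) (max-class τ (τ-max c₁))) ⟩
        x + + t            ∎
        where
        open ℤ.≤-Reasoning
        c₁ : ℤ
        c₁ = c (suc k)
        s*δ≤0 : + s * δ c₁ ≤ 0ℤ
        s*δ≤0 = subst (+ s * δ c₁ ≤_) (ℤ.*-zeroʳ (+ s)) (ℤ.*-monoˡ-≤-nonNeg (+ s) (δ-after-peak k k<s maximal))

open import Data.Nat using (ℕ; _<_)
open import Data.Nat.Coprimality using (Coprime)
open import Data.Integer using (ℤ)
open import Data.Product using (_×_)

open import Data.Nat using (NonZero; z<s; >-nonZero)
open import Data.Nat.Properties using (<-trans)
open import Data.Product using (_,_)
open CoreClosure
open PinchPoints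
open Peaks

lemma3p5 : (s t : ℕ) → 1 < s → 1 < t → Coprime s t →
    (σ τ : Partition) → IsBiCore s t σ → IsBiCore s t τ →
    (x : ℤ) → IsPeak s t σ τ x →
    PinchPoint s t σ x × PinchPoint s t τ x
lemma3p5 s t 1<s 1<t coprime σ τ (σ-s-core , σ-t-core) (τ-s-core , τ-t-core) x
         (Mσ , Mτ , δ , σ-max , τ-max , δ-def , k , k<s , maximal , x≡) =
  Pinch.pinch-point s t σ x coprime σ-s-closed σ-t-closed x∈Bσ σ-bound ,
  Pinch.pinch-point s t τ x coprime τ-s-closed τ-t-closed x∈Bτ τ-bound
  where
  0<s : 0 < s
  0<s = <-trans z<s 1<s
  0<t : 0 < t
  0<t = <-trans z<s 1<t
  instance
    s≢0 : NonZero s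
    s≢0 = >-nonZero 0<s
  σ-s-closed : Closed s σ
  σ-s-closed = core⇒closed s σ 0<s σ-s-core
  σ-t-closed : Closed t σ
  σ-t-closed = core⇒closed t σ 0<t σ-t-core
  τ-s-closed : Closed s τ
  τ-s-closed = core⇒closed s τ 0<s τ-s-core
  τ-t-closed : Closed t τ
  τ-t-closed = core⇒closed t τ 0<t τ-t-core
  open Peak s t coprime σ τ σ-s-closed τ-s-closed Mσ Mτ δ σ-max τ-max δ-def
  open AtPeak k k<s maximal x x≡ τ-t-closed
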